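{- Let $f=f(x_1,\ldots,x_n)$ be a positive threshold non-split Boolean function, let $i\in[n]$ be such that both $f_0=f_{|x_i=0}$ and $f_1=f_{|x_i=1}$ are split, and let $s\in[n]\setminus\{i\}$ be such that $(f_0)_{|x_s=0}\equiv 0$ and $(f_1)_{|x_s=1}\equiv 1$. Then: (a) $x_s$ is a relevant variable of both $f_0$ and $f_1$; (b) for $\alpha_i\in\{0,1\}$, if $(\alpha_1,\ldots,\alpha_{i-1},\alpha_{i+1},\ldots,\alpha_n)\in B^{n-1}$ is an extremal point of $f_{\alpha_i}$, then $(\alpha_1,\ldots,\alpha_{i-1},\alpha_i,\alpha_{i+1},\ldots,\alpha_n)\in B^n$ is an extremal point of $f$.
   Context: $B=\{0,1\}$; for $x,y\in B^m$, $x\preceq y$ means $(x)_j=1$ implies $(y)_j=1$. $f$ is positive if $f(x)=1$ and $x\preceq y$ imply $f(y)=1$; threshold if there are reals $w_1,\dots,w_n,t$ with $f(x)=0\iff\sum_jw_jx_j\le t$. For a variable $x_j$ and $\alpha\in B$, $g_{|x_j=\alpha}$ is the function of the remaining variables obtained by fixing $x_j=\alpha$ ($f_0,f_1$ are functions of the variables $x_j$, $j\ne i$). A variable $x_j$ is relevant for $g$ if $g_{|x_j=0}\not\equiv g_{|x_j=1}$. $g$ is split if it has a variable $x_j$ with $g_{|x_j=0}\equiv 0$ or $g_{|x_j=1}\equiv 1$; otherwise non-split. Extremal points of a positive function are its $\preceq$-maximal false points and $\preceq$-minimal true points.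
   Formalization: The weights $w_1,\dots,w_n$ and the threshold $t$ in the definition of a threshold function are rational rather than real. -}

module Defs where

open import Data.Bool using (Bool; true; false; if_then_else_)
open import Data.Nat using (ℕ; suc)
open import Data.Fin using (Fin)
open import Data.Vec.Functional using (Vector; insertAt)
open import Data.Rational using (ℚ; 0ℚ; 1ℚ; _+_; _*_; _≤_)
open import Data.Product using (Σ; ∃; _×_)
open import Data.Sum using (_⊎_)
open import Relation.Nullary using (¬_)
open import Relation.Binary.PropositionalEquality using (_≡_)

BFun : ℕ → Set
BFun n = (Fin n → Bool) → Bool

_≼_ : ∀ {n} → (Fin n → Bool) → (Fin n → Bool) → Set
x ≼ y = ∀ j → x j ≡ true → y j ≡ true

Positive : ∀ {n} → BFun n → Set
Positive {n} f = ∀ (x y : Fin n → Bool) → f x ≡ true → x ≼ y → f y ≡ true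

wsum : ∀ {n} → (Fin n → ℚ) → (Fin n → Bool) → ℚ
wsum {n} w x = Data.Vec.Functional.foldr _+_ 0ℚ {n}
  (λ j → w j * (if x j then 1ℚ else 0ℚ))

Threshold : ∀ {n} → BFun n → Set
Threshold {n} f = Σ (Fin n → ℚ) λ w → Σ ℚ λ t →
  ∀ x → (f x ≡ false → wsum w x ≤ t) × (wsum w x ≤ t → f x ≡ false)

restrict : ∀ {n} → BFun (suc n) → Fin (suc n) → Bool → BFun n
restrict g j α y = g (insertAt y j α)

IsConst0 : ∀ {n} → BFun n → Set
IsConst0 g = ∀ y → g y ≡ false

IsConst1 : ∀ {n} → BFun n → Set
IsConst1 g = ∀ y → g y ≡ true

Relevant : ∀ {n} → BFun (suc n) → Fin (suc n) → Set
Relevant g j = ¬ (∀ y → restrict g j false y ≡ restrict g j true y)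

Split : ∀ {n} → BFun (suc n) → Set
Split g = ∃ λ j → IsConst0 (restrict g j false) ⊎ IsConst1 (restrict g j true)

NonSplit : ∀ {n} → BFun (suc n) → Set
NonSplit g = ¬ Split g

MaxFalse : ∀ {n} → BFun n → (Fin n → Bool) → Set
MaxFalse g x = g x ≡ false × (∀ y → x ≼ y → g y ≡ false → ∀ j → y j ≡ x j)

MinTrue : ∀ {n} → BFun n → (Fin n → Bool) → Set
MinTrue g x = g x ≡ true × (∀ y → y ≼ x → g y ≡ true → ∀ j → y j ≡ x j)

Extremal : ∀ {n} → BFun n → (Fin n → Bool) → Set
Extremal g x = MaxFalse g x ⊎ MinTrue g x

-- (a) If x_s were irrelevant for f₀, then f₀ would coincide with (f₀)|x_s=0 ≡ 0 and f would
-- split at x_i; dually for f₁.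
-- (b) An extremal point x of f_α, extended by x_i = α, stays extremal for f unless a point y of
-- f with the same value, comparable to it, has y_i ≠ α. In two of the four cases comparability
-- already forces y_i = α. For a maximal false point x of f₀ and a false y ≽ (x, x_i = 0) with
-- y_i = 1, y is a false point of f₁, so y_s = 0 because (f₁)|x_s=1 ≡ 1; hence x_s = 0, and since
-- (f₀)|x_s=0 ≡ 0, maximality of x forces x_k = 1 for every k ≠ s. So y is 1 outside x_s, and
-- f(y) = 0 makes f|x_s=0 ≡ 0: f splits. Minimal true points of f₁ are dual.
module Submission where

open import Defs
open import Data.Bool using (Bool; true; false)
open import Data.Nat using (ℕ; suc)
open import Data.Fin using (Fin; punchIn; _≟_)
open import Data.Fin.Properties using (punchIn-punchOut; punchInᵢ≢i)
open import Data.Vec.Functional using (insertAt; removeAt; updateAt)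
open import Data.Vec.Functional.Properties
  using (insertAt-lookup; insertAt-punchIn; updateAt-updates; updateAt-minimal)
open import Data.Product using (_×_; _,_)
open import Data.Sum using (inj₁; inj₂)
open import Function using (_∘_; const)
open import Relation.Nullary using (yes; no; contradiction)
open import Relation.Binary.PropositionalEquality
  using (_≡_; _≢_; _≗_; refl; sym; trans; cong; subst)

private variable
  m : ℕ

≡true⇒≢false : ∀ {b} → b ≡ true → b ≢ false
≡true⇒≢false refl ()

≼-false : ∀ {x y : Fin m → Bool} {k} → x ≼ y → y k ≡ false → x k ≡ false
≼-false {x = x} {k = k} x≼y yk with x k in xk
... | false = refl
... | true  = contradiction yk (≡true⇒≢false (x≼y k xk))

data PunchView {m} (i : Fin (suc m)) : Fin (suc m) → Set where
  here    : PunchView i i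
  punched : (k : Fin m) → PunchView i (punchIn i k)

punchView : (i k : Fin (suc m)) → PunchView i k
punchView i k with k ≟ i
... | yes refl = here
... | no  k≢i  = subst (PunchView i) (punchIn-punchOut (k≢i ∘ sym)) (punched _)

insertAt-mono : ∀ {x y : Fin m → Bool} j a → x ≼ y → insertAt x j a ≼ insertAt y j a
insertAt-mono {x = x} {y} j a x≼y k with punchView j k
... | here       rewrite insertAt-lookup x j a | insertAt-lookup y j a = λ h → h
... | punched k' rewrite insertAt-punchIn x j a k' | insertAt-punchIn y j a k' = x≼y k'

insertAt≼⇒≼removeAt : ∀ {x : Fin m → Bool} {y i a} → insertAt x i a ≼ y → x ≼ removeAt y i
insertAt≼⇒≼removeAt {x = x} {i = i} {a} le k xk =
  le (punchIn i k) (trans (insertAt-punchIn x i a k) xk)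

≼insertAt⇒removeAt≼ : ∀ {x : Fin m → Bool} {y i a} → y ≼ insertAt x i a → removeAt y i ≼ x
≼insertAt⇒removeAt≼ {x = x} {i = i} {a} le k yk =
  trans (sym (insertAt-punchIn x i a k)) (le (punchIn i k) yk)

≗-insertAt : ∀ {x : Fin m → Bool} {y i a} → y i ≡ a → removeAt y i ≗ x → y ≗ insertAt x i a
≗-insertAt {x = x} {i = i} {a} yi rest k with punchView i k
... | here       = trans yi (sym (insertAt-lookup x i a))
... | punched k' = trans (rest k') (sym (insertAt-punchIn x i a k'))

-- Without function extensionality a Boolean function need not respect ≗; a positive one does.
positive-cong : ∀ {g : BFun m} {x y} → Positive g → x ≗ y → g x ≡ g y
positive-cong {g = g} {x} {y} P x≗y with g x in gx | g y in gy
... | true  | true  = refl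
... | false | false = refl
... | true  | false = contradiction gy (≡true⇒≢false (P x y gx λ k → trans (sym (x≗y k))))
... | false | true  = contradiction gx (≡true⇒≢false (P y x gy λ k → trans (x≗y k)))

positive-false : ∀ {g : BFun m} {x y} → Positive g → x ≼ y → g y ≡ false → g x ≡ false
positive-false {g = g} {x} {y} P x≼y gy with g x in gx
... | false = refl
... | true  = contradiction gy (≡true⇒≢false (P x y gx x≼y))

restrict-positive : ∀ {g : BFun (suc m)} → Positive g → ∀ j a → Positive (restrict g j a)
restrict-positive P j a x y gx x≼y = P _ _ gx (insertAt-mono j a x≼y)

restrict-removeAt : ∀ {g : BFun (suc m)} {z a} → Positive g
  → ∀ j → z j ≡ a → g z ≡ restrict g j a (removeAt z j)
restrict-removeAt P j zj = positive-cong P (≗-insertAt zj λ _ → refl)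

Irrelevant : BFun (suc m) → Fin (suc m) → Set
Irrelevant g j = ∀ y → restrict g j false y ≡ restrict g j true y

irrelevant-const0 : ∀ {g : BFun (suc m)} {j} → Positive g → Irrelevant g j
  → IsConst0 (restrict g j false) → IsConst0 g
irrelevant-const0 {j = j} P irr c0 z with z j in zj
... | false = trans (restrict-removeAt P j zj) (c0 _)
... | true  = trans (restrict-removeAt P j zj) (trans (sym (irr _)) (c0 _))

irrelevant-const1 : ∀ {g : BFun (suc m)} {j} → Positive g → Irrelevant g j
  → IsConst1 (restrict g j true) → IsConst1 g
irrelevant-const1 {j = j} P irr c1 z with z j in zj
... | true  = trans (restrict-removeAt P j zj) (c1 _)
... | false = trans (restrict-removeAt P j zj) (trans (irr _) (c1 _))

const1-restrict⇒false-at : ∀ {g : BFun (suc m)} {j y} → Positive g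
  → IsConst1 (restrict g j true) → g y ≡ false → y j ≡ false
const1-restrict⇒false-at {j = j} {y} P c1 gy with y j in yj
... | false = refl
... | true  = contradiction gy (≡true⇒≢false (trans (restrict-removeAt P j yj) (c1 _)))

const0-restrict⇒true-at : ∀ {g : BFun (suc m)} {j y} → Positive g
  → IsConst0 (restrict g j false) → g y ≡ true → y j ≡ true
const0-restrict⇒true-at {j = j} {y} P c0 gy with y j in yj
... | true  = refl
... | false = contradiction (trans (restrict-removeAt P j yj) (c0 _)) (≡true⇒≢false gy)

TrueExcept : Fin m → (Fin m → Bool) → Set
TrueExcept j y = ∀ k → k ≢ j → y k ≡ true

FalseExcept : Fin m → (Fin m → Bool) → Set
FalseExcept j y = ∀ k → k ≢ j → y k ≡ false

maxFalse⇒trueExcept : ∀ {g : BFun (suc m)} {s x} → Positive g → IsConst0 (restrict g s false)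
  → MaxFalse g x → x s ≡ false → TrueExcept s x
maxFalse⇒trueExcept {g = g} {s} {x} P c0 (_ , maximal) xs k k≢s with x k in xk
... | true  = refl
... | false = contradiction (trans (maximal z x≼z gz k) xk) (≡true⇒≢false (updateAt-updates k x))
  where
  z : Fin _ → Bool
  z = updateAt x k (const true)
  x≼z : x ≼ z
  x≼z l xl with l ≟ k
  ... | yes refl = updateAt-updates l x
  ... | no  l≢k  = trans (updateAt-minimal l k x l≢k) xl
  gz : g z ≡ false
  gz = trans (restrict-removeAt P s (trans (updateAt-minimal s k x (k≢s ∘ sym)) xs)) (c0 _)

minTrue⇒falseExcept : ∀ {g : BFun (suc m)} {s x} → Positive g → IsConst1 (restrict g s true)
  → MinTrue g x → x s ≡ true → FalseExcept s x
minTrue⇒falseExcept {g = g} {s} {x} P c1 (_ , minimal) xs k k≢s with x k in xk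
... | false = refl
... | true  = contradiction (updateAt-updates k x) (≡true⇒≢false (trans (minimal z z≼x gz k) xk))
  where
  z : Fin _ → Bool
  z = updateAt x k (const false)
  z≼x : z ≼ x
  z≼x l zl with l ≟ k
  ... | yes refl = contradiction (updateAt-updates l x) (≡true⇒≢false zl)
  ... | no  l≢k  = trans (sym (updateAt-minimal l k x l≢k)) zl
  gz : g z ≡ true
  gz = trans (restrict-removeAt P s (trans (updateAt-minimal s k x (k≢s ∘ sym)) xs)) (c1 _)

trueExcept-punchIn : ∀ {y : Fin (suc (suc m)) → Bool} {i s} → y i ≡ true
  → TrueExcept s (removeAt y i) → TrueExcept (punchIn i s) y
trueExcept-punchIn {i = i} yi rest k k≢j with punchView i k
... | here       = yi
... | punched k' = rest k' (k≢j ∘ cong (punchIn i))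

falseExcept-punchIn : ∀ {y : Fin (suc (suc m)) → Bool} {i s} → y i ≡ false
  → FalseExcept s (removeAt y i) → FalseExcept (punchIn i s) y
falseExcept-punchIn {i = i} yi rest k k≢j with punchView i k
... | here       = yi
... | punched k' = rest k' (k≢j ∘ cong (punchIn i))

trueExcept-false⇒const0 : ∀ {g : BFun (suc m)} {j y} → Positive g
  → g y ≡ false → TrueExcept j y → IsConst0 (restrict g j false)
trueExcept-false⇒const0 {j = j} {y} P gy yTrue w = positive-false P below gy
  where
  below : insertAt w j false ≼ y
  below k with punchView j k
  ... | here       = λ h → contradiction (insertAt-lookup w j false) (≡true⇒≢false h)
  ... | punched k' = λ _ → yTrue (punchIn j k') (punchInᵢ≢i j k')

falseExcept-true⇒const1 : ∀ {g : BFun (suc m)} {j y} → Positive g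
  → g y ≡ true → FalseExcept j y → IsConst1 (restrict g j true)
falseExcept-true⇒const1 {j = j} {y} P gy yFalse w = P y _ gy above
  where
  above : y ≼ insertAt w j true
  above k with punchView j k
  ... | here       = λ _ → insertAt-lookup w j true
  ... | punched k' = λ h → contradiction (yFalse (punchIn j k') (punchInᵢ≢i j k')) (≡true⇒≢false h)

maxFalse-insertAt : ∀ {g : BFun (suc m)} {i a x} → Positive g → MaxFalse (restrict g i a) x
  → (∀ y → insertAt x i a ≼ y → g y ≡ false → y i ≡ a)
  → MaxFalse g (insertAt x i a)
maxFalse-insertAt {i = i} P (gx , maximal) forced = gx , λ y le gy →
  ≗-insertAt (forced y le gy)
    (maximal (removeAt y i) (insertAt≼⇒≼removeAt le)
      (trans (sym (restrict-removeAt P i (forced y le gy))) gy))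

minTrue-insertAt : ∀ {g : BFun (suc m)} {i a x} → Positive g → MinTrue (restrict g i a) x
  → (∀ y → y ≼ insertAt x i a → g y ≡ true → y i ≡ a)
  → MinTrue g (insertAt x i a)
minTrue-insertAt {i = i} P (gx , minimal) forced = gx , λ y le gy →
  ≗-insertAt (forced y le gy)
    (minimal (removeAt y i) (≼insertAt⇒removeAt≼ le)
      (trans (sym (restrict-removeAt P i (forced y le gy))) gy))

module BothRestrictionsSplit {n} (f : BFun (suc (suc n))) (i : Fin (suc (suc n))) (s : Fin (suc n))
  (P : Positive f) (nonSplit : NonSplit f)
  (f₀-const0 : IsConst0 (restrict (restrict f i false) s false))
  (f₁-const1 : IsConst1 (restrict (restrict f i true) s true)) where

  P₀ : Positive (restrict f i false)
  P₀ = restrict-positive P i false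

  P₁ : Positive (restrict f i true)
  P₁ = restrict-positive P i true

  relevant₀ : Relevant (restrict f i false) s
  relevant₀ irr = nonSplit (i , inj₁ (irrelevant-const0 {j = s} P₀ irr f₀-const0))

  relevant₁ : Relevant (restrict f i true) s
  relevant₁ irr = nonSplit (i , inj₂ (irrelevant-const1 {j = s} P₁ irr f₁-const1))

  maxFalse₀-forced : ∀ {x} → MaxFalse (restrict f i false) x
    → ∀ y → insertAt x i false ≼ y → f y ≡ false → y i ≡ false
  maxFalse₀-forced {x} mf y le fy with y i in yi
  ... | false = refl
  ... | true  = contradiction (punchIn i s , inj₁ (trueExcept-false⇒const0 P fy yTrue)) nonSplit
    where
    ys : removeAt y i s ≡ false
    ys = const1-restrict⇒false-at P₁ f₁-const1 (trans (sym (restrict-removeAt P i yi)) fy)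
    xTrue : TrueExcept s x
    xTrue = maxFalse⇒trueExcept P₀ f₀-const0 mf (≼-false (insertAt≼⇒≼removeAt le) ys)
    yTrue : TrueExcept (punchIn i s) y
    yTrue = trueExcept-punchIn yi λ k k≢s → insertAt≼⇒≼removeAt le k (xTrue k k≢s)

  minTrue₁-forced : ∀ {x} → MinTrue (restrict f i true) x
    → ∀ y → y ≼ insertAt x i true → f y ≡ true → y i ≡ true
  minTrue₁-forced {x} mt y le fy with y i in yi
  ... | true  = refl
  ... | false = contradiction (punchIn i s , inj₂ (falseExcept-true⇒const1 P fy yFalse)) nonSplit
    where
    ys : removeAt y i s ≡ true
    ys = const0-restrict⇒true-at P₀ f₀-const0 (trans (sym (restrict-removeAt P i yi)) fy)
    xFalse : FalseExcept s x
    xFalse = minTrue⇒falseExcept P₁ f₁-const1 mt (≼insertAt⇒removeAt≼ le s ys)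
    yFalse : FalseExcept (punchIn i s) y
    yFalse = falseExcept-punchIn yi λ k k≢s → ≼-false (≼insertAt⇒removeAt≼ le) (xFalse k k≢s)

  extremal-insertAt : ∀ a x → Extremal (restrict f i a) x → Extremal f (insertAt x i a)
  extremal-insertAt false x (inj₁ mf) =
    inj₁ (maxFalse-insertAt P mf (maxFalse₀-forced mf))
  extremal-insertAt true  x (inj₁ mf) =
    inj₁ (maxFalse-insertAt P mf λ y le _ → le i (insertAt-lookup x i true))
  extremal-insertAt false x (inj₂ mt) =
    inj₂ (minTrue-insertAt P mt λ y le _ → ≼-false {k = i} le (insertAt-lookup x i false))
  extremal-insertAt true  x (inj₂ mt) =
    inj₂ (minTrue-insertAt P mt (minTrue₁-forced mt))

corollary1 : ∀ (n : ℕ) (f : BFun (suc (suc n))) (i : Fin (suc (suc n))) (s : Fin (suc n))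
    → Positive f → Threshold f → NonSplit f
    → Split (restrict f i false) → Split (restrict f i true)
    → IsConst0 (restrict (restrict f i false) s false)
    → IsConst1 (restrict (restrict f i true) s true)
    → (Relevant (restrict f i false) s × Relevant (restrict f i true) s)
      × (∀ (α : Bool) (x : Fin (suc n) → Bool)
           → Extremal (restrict f i α) x → Extremal f (insertAt x i α))
corollary1 n f i s P _ nonSplit _ _ f₀-const0 f₁-const1 =
  (relevant₀ , relevant₁) , extremal-insertAt
  where open BothRestrictionsSplit f i s P nonSplit f₀-const0 f₁-const1
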